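{- Let $p$ be a prime and let $d_1 > d_2 \geq 0$ be integers. Let $G = (\mathbb{Z}/p\mathbb{Z})^{d_1}$ and $H = (\mathbb{Z}/p\mathbb{Z})^{d_2}$. Then $\rho_G^-(r) = \rho_H^-(r)$ for all integers $1 \leq r \leq p^{d_2}$.
   Context: For subsets $A,B$ of an abelian group $G$, $A - B = \{a - b \mid a \in A, b \in B\}$. For a finite abelian group $G$ of order $N$ and $1 \leq r \leq N$, $\rho_G^-(r) = \min\{|A - A| \mid A \subseteq G, |A| = r\}$. -}

module Defs where

open import Data.Nat using (ℕ; zero; suc; _+_; _∸_; _≤_)
open import Data.Nat.DivMod using (_mod_)
open import Data.Fin using (Fin; toℕ)
open import Data.Fin.Properties using (_≟_)
open import Data.Vec using (Vec; zipWith)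
open import Data.Vec.Properties using (≡-dec)
open import Data.List using (List; length; map; concatMap; deduplicate)
open import Data.List.Relation.Unary.Unique.Propositional using (Unique)
open import Data.Product using (Σ; _×_)
open import Relation.Binary.PropositionalEquality using (_≡_)
open import Relation.Binary.Definitions using (DecidableEquality)

_-ₚ_ : {p : ℕ} → Fin p → Fin p → Fin p
_-ₚ_ {suc n} a b = (toℕ a + (suc n ∸ toℕ b)) mod (suc n)

Grp : ℕ → ℕ → Set
Grp p d = Vec (Fin p) d

_-ᴳ_ : {p d : ℕ} → Grp p d → Grp p d → Grp p d
_-ᴳ_ = zipWith _-ₚ_

_≟ᴳ_ : {p d : ℕ} → DecidableEquality (Grp p d)
_≟ᴳ_ = ≡-dec _≟_

-- A finite subset A ⊆ G is given by a duplicate-free list of its elements; |A| = length.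
-- The list of all differences a - b (a, b ∈ A), possibly with repetitions.
diffList : {p d : ℕ} → List (Grp p d) → List (Grp p d)
diffList A = concatMap (λ a → map (λ b → a -ᴳ b) A) A

card-diff : {p d : ℕ} → List (Grp p d) → ℕ
card-diff A = length (deduplicate _≟ᴳ_ (diffList A))

-- IsRho p d r m  :⇔  m = ρ⁻_G(r) for G = (ℤ/pℤ)^d, i.e. m is the minimum of |A - A|
-- over subsets A ⊆ G with |A| = r (attained, and a lower bound).
IsRho : ℕ → ℕ → ℕ → ℕ → Set
IsRho p d r m =
  Σ (List (Grp p d)) (λ A → Unique A × length A ≡ r × card-diff A ≡ m)
  × ((A : List (Grp p d)) → Unique A → length A ≡ r → m ≤ card-diff A)

module Submission where

-- Say d reduces to d' if every r-subset of (ℤ/pℤ)^d can be replaced by an r-subset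
-- of (ℤ/pℤ)^d' with no more differences; reductions both ways give equal minima.
--  * Upwards, x ↦ (0, x) embeds (ℤ/pℤ)^k into (ℤ/pℤ)^(k+1) as a homomorphism.
--  * Downwards, let A ⊆ (ℤ/pℤ)^d₁.  If |A - A| ≥ p^d₂, any r-subset B of (ℤ/pℤ)^d₂
--    does, as |B - B| ≤ p^d₂.  Otherwise |A - A| < p^d₂ ≤ p^k and we project
--    (ℤ/pℤ)^(k+1) → (ℤ/pℤ)^k by π_c (x₀, x) = x - x₀·c.  A difference w = (w₀, w')
--    with w₀ ≠ 0 is killed by π_c for at most one slope c (p is prime), and
--    π_c w = 0 with w₀ = 0 forces w = 0; so by counting some π_c is injective on A.
--    A homomorphism injective on A does not increase |A - A|; iterate down to d₂.

open import Defs
open import Data.Nat using (ℕ; zero; suc; _+_; _*_; _∸_; _^_; _⊓_; _≤_; _<_; _≤′_; ≤′-refl; ≤′-step; z≤n; s≤s)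
open import Data.Nat.Properties
open import Data.Nat.DivMod using (_%_; _mod_; m%n<n; m%n≤n; m%n%n≡m%n; n%n≡0; %-distribˡ-+; %-distribˡ-*; m<n⇒m%n≡m)
open import Data.Nat.Divisibility using (_∣_; m%n≡0⇒n∣m; n∣m⇒m%n≡0)
open import Data.Nat.Primality using (Prime; euclidsLemma; ¬prime[0])
open import Data.Nat.Solver using (module +-*-Solver)
open import Data.Fin using (Fin; toℕ) renaming (zero to 0F)
open import Data.Fin.Properties using (toℕ-fromℕ<; toℕ-injective; toℕ<n) renaming (_≟_ to _≟F_)
open import Data.Vec using ([]; _∷_; head; replicate) renaming (map to vmap)
open import Data.Vec.Properties using (∷-injective; ∷-injectiveʳ)
open import Data.List using (List; []; _∷_; length; map; filter; take; deduplicate; cartesianProductWith; allFin)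
open import Data.List.Properties using (length-map; length-take; length-tabulate; length-++; filter-all)
open import Data.List.Membership.Propositional using (_∈_; find; lose)
open import Data.List.Membership.Propositional.Properties using (∈-map⁺; ∈-map⁻; ∈-concatMap⁺; ∈-concatMap⁻; ∈-filter⁻; deduplicate-∈⇔; ∈-cartesianProductWith⁺; ∈-allFin)
open import Data.List.Relation.Unary.All using (All; []; _∷_)
open import Data.List.Relation.Unary.Any using (Any; here; there; any?)
open import Data.List.Relation.Unary.Unique.Propositional using (Unique; []; _∷_)
import Data.List.Relation.Unary.Unique.Propositional.Properties as Unique
open import Data.List.Relation.Unary.Unique.DecPropositional.Properties using (deduplicate-!)
open import Data.Product using (_×_; _,_; ∃)
open import Data.Sum using (inj₁; inj₂; [_,_]′)
open import Data.Empty using (⊥-elim)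
open import Function.Bundles using (_⇔_; mk⇔; Equivalence)
open import Relation.Nullary using (¬_; Dec; yes; no; ¬?)
open import Relation.Nullary.Decidable using (_×-dec_; decidable-stable)
open import Relation.Binary.PropositionalEquality hiding ([_])
open import Relation.Binary.Bundles using (Setoid)
open import Relation.Binary.Definitions using (DecidableEquality)

module ZMod (n : ℕ) where

  P : ℕ
  P = suc n

  -- Congruence modulo P on ℕ (a record, so that its indices can be inferred).
  record _≈_ (a b : ℕ) : Set where
    constructor same-residue
    field residue-≡ : a % P ≡ b % P
  open _≈_
  infix 4 _≈_

  ≈-setoid : Setoid _ _
  ≈-setoid = record
    { Carrier = ℕ ; _≈_ = _≈_
    ; isEquivalence = record
      { refl = same-residue refl
      ; sym = λ e → same-residue (sym (residue-≡ e))
      ; trans = λ e f → same-residue (trans (residue-≡ e) (residue-≡ f)) } }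

  open Setoid ≈-setoid public using () renaming (refl to ≈-refl; sym to ≈-sym; trans to ≈-trans)

  ≡⇒≈ : ∀ {a b} → a ≡ b → a ≈ b
  ≡⇒≈ refl = ≈-refl

  ≈-cong+ : ∀ {a a' b b'} → a ≈ a' → b ≈ b' → a + b ≈ a' + b'
  ≈-cong+ {a} {a'} {b} {b'} (same-residue e) (same-residue f) = same-residue (begin
    (a + b) % P            ≡⟨ %-distribˡ-+ a b P ⟩
    (a % P + b % P) % P    ≡⟨ cong₂ (λ x y → (x + y) % P) e f ⟩
    (a' % P + b' % P) % P  ≡⟨ %-distribˡ-+ a' b' P ⟨
    (a' + b') % P          ∎)
    where open ≡-Reasoning

  ≈-cong* : ∀ {a a' b b'} → a ≈ a' → b ≈ b' → a * b ≈ a' * b'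
  ≈-cong* {a} {a'} {b} {b'} (same-residue e) (same-residue f) = same-residue (begin
    (a * b) % P              ≡⟨ %-distribˡ-* a b P ⟩
    (a % P * (b % P)) % P    ≡⟨ cong₂ (λ x y → (x * y) % P) e f ⟩
    (a' % P * (b' % P)) % P  ≡⟨ %-distribˡ-* a' b' P ⟨
    (a' * b') % P            ∎)
    where open ≡-Reasoning

  %-≈ : ∀ m → m % P ≈ m
  %-≈ m = same-residue (m%n%n≡m%n m P)

  P≈0 : P ≈ 0
  P≈0 = same-residue (n%n≡0 P)

  -- Adding t can be undone modulo P: add the complement P ∸ t % P.
  ≈-cancelʳ-+ : ∀ {a b} t → a + t ≈ b + t → a ≈ b
  ≈-cancelʳ-+ {a} {b} t e = begin
    a              ≡⟨ +-identityʳ a ⟨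
    a + 0          ≈⟨ ≈-cong+ ≈-refl (≈-sym t+u≈0) ⟩
    a + (t + u)    ≡⟨ +-assoc a t u ⟨
    a + t + u      ≈⟨ ≈-cong+ e ≈-refl ⟩
    b + t + u      ≡⟨ +-assoc b t u ⟩
    b + (t + u)    ≈⟨ ≈-cong+ ≈-refl t+u≈0 ⟩
    b + 0          ≡⟨ +-identityʳ b ⟩
    b              ∎
    where
    open import Relation.Binary.Reasoning.Setoid ≈-setoid
    u : ℕ
    u = P ∸ t % P
    t+u≈0 : t + u ≈ 0
    t+u≈0 = ≈-trans (≈-cong+ (≈-sym (%-≈ t)) ≈-refl) (≈-trans (≡⇒≈ (m+[n∸m]≡n (m%n≤n t P))) P≈0)

  mod-≈ : ∀ m → toℕ (m mod P) ≈ m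
  mod-≈ m = ≈-trans (≡⇒≈ (toℕ-fromℕ< (m%n<n m P))) (%-≈ m)

  residue-injective : ∀ {x y : Fin P} → toℕ x ≈ toℕ y → x ≡ y
  residue-injective {x} {y} (same-residue e) =
    toℕ-injective (trans (sym (m<n⇒m%n≡m (toℕ<n x))) (trans e (m<n⇒m%n≡m (toℕ<n y))))

  _*ₚ_ : Fin P → Fin P → Fin P
  a *ₚ b = (toℕ a * toℕ b) mod P

  -ₚ-spec : ∀ x y → toℕ (x -ₚ y) + toℕ y ≈ toℕ x
  -ₚ-spec x y = begin
    toℕ (x -ₚ y) + toℕ y             ≈⟨ ≈-cong+ (mod-≈ (toℕ x + (P ∸ toℕ y))) ≈-refl ⟩
    toℕ x + (P ∸ toℕ y) + toℕ y      ≡⟨ +-assoc (toℕ x) _ _ ⟩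
    toℕ x + (P ∸ toℕ y + toℕ y)      ≡⟨ cong (toℕ x +_) (m∸n+n≡m (<⇒≤ (toℕ<n y))) ⟩
    toℕ x + P                        ≈⟨ ≈-cong+ ≈-refl P≈0 ⟩
    toℕ x + 0                        ≡⟨ +-identityʳ (toℕ x) ⟩
    toℕ x                            ∎
    where open import Relation.Binary.Reasoning.Setoid ≈-setoid

  -ₚ-unique : ∀ {z x y} → toℕ z + toℕ y ≈ toℕ x → z ≡ x -ₚ y
  -ₚ-unique {z} {x} {y} e = residue-injective (≈-cancelʳ-+ (toℕ y) (≈-trans e (≈-sym (-ₚ-spec x y))))

  -ₚ-self : ∀ x → x -ₚ x ≡ 0F
  -ₚ-self x = sym (-ₚ-unique {x = x} {y = x} ≈-refl)

  -ₚ≡0⇒≡ : ∀ {x y} → x -ₚ y ≡ 0F → x ≡ y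
  -ₚ≡0⇒≡ {x} {y} e = residue-injective (≈-sym (subst (λ z → toℕ z + toℕ y ≈ toℕ x) e (-ₚ-spec x y)))

  *ₚ-zeroˡ : ∀ c → 0F *ₚ c ≡ 0F
  *ₚ-zeroˡ c = refl

  -- The affine identity behind the linearity of the projections π_c:
  -- (a - a₀c) - (b - b₀c) = (a - b) - (a₀ - b₀)c.  By -ₚ-unique it suffices that the
  -- left side L satisfies L + (a₀ - b₀)c + b ≈ a, which follows from -ₚ-spec.
  -ₚ-affine : ∀ a b a₀ b₀ c →
    (a -ₚ (a₀ *ₚ c)) -ₚ (b -ₚ (b₀ *ₚ c)) ≡ (a -ₚ b) -ₚ ((a₀ -ₚ b₀) *ₚ c)
  -ₚ-affine a b a₀ b₀ c = -ₚ-unique (≈-cancelʳ-+ (toℕ b) (begin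
    L + toℕ ((a₀ -ₚ b₀) *ₚ c) + toℕ b   ≈⟨ ≈-cong+ (≈-cong+ ≈-refl (mod-≈ (q * toℕ c))) b≈ ⟩
    L + q * toℕ c + (v + b₀c)           ≡⟨ rearrange L q (toℕ c) v (toℕ b₀) ⟩
    (L + v) + (q + toℕ b₀) * toℕ c      ≈⟨ ≈-cong+ (-ₚ-spec _ _) (≈-cong* (-ₚ-spec a₀ b₀) ≈-refl) ⟩
    u + toℕ a₀ * toℕ c                  ≈⟨ ≈-cong+ ≈-refl (≈-sym (mod-≈ (toℕ a₀ * toℕ c))) ⟩
    u + toℕ (a₀ *ₚ c)                   ≈⟨ -ₚ-spec a (a₀ *ₚ c) ⟩
    toℕ a                               ≈⟨ -ₚ-spec a b ⟨
    toℕ (a -ₚ b) + toℕ b                ∎))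
    where
    open import Relation.Binary.Reasoning.Setoid ≈-setoid
    open +-*-Solver using (solve; _:+_; _:*_; _:=_)
    L u v q b₀c : ℕ
    L = toℕ ((a -ₚ (a₀ *ₚ c)) -ₚ (b -ₚ (b₀ *ₚ c)))
    u = toℕ (a -ₚ (a₀ *ₚ c))
    v = toℕ (b -ₚ (b₀ *ₚ c))
    q = toℕ (a₀ -ₚ b₀)
    b₀c = toℕ b₀ * toℕ c
    b≈ : toℕ b ≈ v + b₀c
    b≈ = ≈-sym (≈-trans (≈-cong+ ≈-refl (≈-sym (mod-≈ b₀c))) (-ₚ-spec b (b₀ *ₚ c)))
    rearrange : ∀ L q c v b₀ → L + q * c + (v + b₀ * c) ≡ (L + v) + (q + b₀) * c
    rearrange = solve 5 (λ L q c v b₀ → L :+ q :* c :+ (v :+ b₀ :* c) := (L :+ v) :+ (q :+ b₀) :* c) refl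

  multiple-below-P : ∀ {m} → m < P → P ∣ m → m ≡ 0
  multiple-below-P {m} m<P P∣m = trans (sym (m<n⇒m%n≡m m<P)) (n∣m⇒m%n≡0 m P P∣m)

  module _ (isPrime : Prime P) where

    -- Via Euclid's lemma: P divides a(y - x) but not a, so y - x = 0.
    *-cancel-≤ : ∀ {a x y} → a ≢ 0 → a < P → y < P → x ≤ y → a * x ≈ a * y → x ≡ y
    *-cancel-≤ {a} {x} {y} a≢0 a<P y<P x≤y ax≈ay with euclidsLemma a d isPrime P∣ad
      where
      d : ℕ
      d = y ∸ x
      ay≡ad+ax : a * y ≡ a * d + a * x
      ay≡ad+ax = begin
        a * y            ≡⟨ cong (a *_) (m+[n∸m]≡n x≤y) ⟨
        a * (x + d)      ≡⟨ *-distribˡ-+ a x d ⟩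
        a * x + a * d    ≡⟨ +-comm (a * x) (a * d) ⟩
        a * d + a * x    ∎
        where open ≡-Reasoning
      ad≈0 : a * d ≈ 0
      ad≈0 = ≈-cancelʳ-+ (a * x) (≈-sym (≈-trans ax≈ay (≡⇒≈ ay≡ad+ax)))
      P∣ad : P ∣ a * d
      P∣ad = m%n≡0⇒n∣m (a * d) P (_≈_.residue-≡ ad≈0)
    ... | inj₁ P∣a = ⊥-elim (a≢0 (multiple-below-P a<P P∣a))
    ... | inj₂ P∣d = begin
      x                ≡⟨ +-identityʳ x ⟨
      x + 0            ≡⟨ cong (x +_) (multiple-below-P (≤-<-trans (m∸n≤m y x) y<P) P∣d) ⟨
      x + (y ∸ x)      ≡⟨ m+[n∸m]≡n x≤y ⟩
      y                ∎
      where open ≡-Reasoning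

    *ₚ-cancelˡ : ∀ {w c c'} → w ≢ 0F → w *ₚ c ≡ w *ₚ c' → c ≡ c'
    *ₚ-cancelˡ {w} {c} {c'} w≢0 wc≡wc' =
      [ (λ c≤c' → toℕ-injective (cancel (toℕ<n c') c≤c' wc≈wc'))
      , (λ c'≤c → sym (toℕ-injective (cancel (toℕ<n c) c'≤c (≈-sym wc≈wc'))))
      ]′ (≤-total (toℕ c) (toℕ c'))
      where
      cancel : ∀ {x y} → y < P → x ≤ y → toℕ w * x ≈ toℕ w * y → x ≡ y
      cancel = *-cancel-≤ (λ w≡0 → w≢0 (toℕ-injective w≡0)) (toℕ<n w)
      wc≈wc' : toℕ w * toℕ c ≈ toℕ w * toℕ c'
      wc≈wc' = ≈-trans (≈-sym (mod-≈ (toℕ w * toℕ c))) (≈-trans (≡⇒≈ (cong toℕ wc≡wc')) (mod-≈ (toℕ w * toℕ c')))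

module Counting {A B : Set} (R : A → B → Set) (R? : ∀ a b → Dec (R a b))
                (R-determines : ∀ {u u' v} → R u v → R u' v → u ≡ u') where

  -- Since v is related to at most one member of U, discarding the members related
  -- to v shortens U by at most one.
  discard-related : ∀ v (U : List A) → Unique U →
    length U ≤ suc (length (filter (λ u → ¬? (R? u v)) U))
  discard-related v [] _ = z≤n
  discard-related v (u ∷ U) (u∉U ∷ uniqueU) with R? u v
  ... | yes uRv = s≤s (≤-reflexive (sym (cong length (filter-all (λ u → ¬? (R? u v)) (others U u∉U)))))
    where
    others : ∀ W → All (λ x → ¬ u ≡ x) W → All (λ x → ¬ R x v) W
    others [] [] = []
    others (x ∷ W) (u≢x ∷ rest) = (λ xRv → u≢x (R-determines uRv xRv)) ∷ others W rest
  ... | no _ = s≤s (discard-related v U uniqueU)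

  covering-length : (V : List B) (U : List A) → Unique U →
    (∀ {u} → u ∈ U → ∃ λ v → v ∈ V × R u v) → length U ≤ length V
  covering-length [] [] _ _ = z≤n
  covering-length [] (u ∷ U) _ covered with covered (here refl)
  ... | _ , () , _
  covering-length (v ∷ V) U uniqueU covered =
    ≤-trans (discard-related v U uniqueU)
            (s≤s (covering-length V U' (Unique.filter⁺ _ uniqueU) covered'))
    where
    U' : List A
    U' = filter (λ u → ¬? (R? u v)) U
    covered' : ∀ {u} → u ∈ U' → ∃ λ v' → v' ∈ V × R u v'
    covered' u∈U' with ∈-filter⁻ (λ u → ¬? (R? u v)) u∈U'
    ... | u∈U , ¬uRv with covered u∈U
    ... | _ , here refl , uRv = ⊥-elim (¬uRv uRv)
    ... | v' , there v'∈V , uRv' = v' , v'∈V , uRv'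

  unrelated-exists : (V : List B) (U : List A) → Unique U → length V < length U →
    ∃ λ u → u ∈ U × ¬ Any (R u) V
  unrelated-exists V U uniqueU V<U with any? (λ u → ¬? (any? (R? u) V)) U
  ... | yes found = find found
  ... | no none = ⊥-elim (<⇒≱ V<U (covering-length V U uniqueU covered))
    where
    covered : ∀ {u} → u ∈ U → ∃ λ v → v ∈ V × R u v
    covered {u} u∈U = find (decidable-stable (any? (R? u) V) (λ unrelated → none (lose u∈U unrelated)))

⊆-length : {A : Set} → DecidableEquality A → {U V : List A} → Unique U →
  (∀ {u} → u ∈ U → u ∈ V) → length U ≤ length V
⊆-length _≟_ {U} {V} uniqueU U⊆V =
  Counting.covering-length _≡_ _≟_ (λ u≡v u'≡v → trans u≡v (sym u'≡v)) V U uniqueU (λ {u} u∈U → u , U⊆V u∈U , refl)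

map-Unique : {A B : Set} (f : A → B) (U : List A) → Unique U →
  (∀ {a b} → a ∈ U → b ∈ U → f a ≡ f b → a ≡ b) → Unique (map f U)
map-Unique f [] _ _ = []
map-Unique f (u ∷ U) (u∉U ∷ uniqueU) injective =
  images U u∉U there ∷ map-Unique f U uniqueU (λ a∈U b∈U → injective (there a∈U) (there b∈U))
  where
  images : ∀ W → All (λ x → ¬ u ≡ x) W → (∀ {b} → b ∈ W → b ∈ u ∷ U) → All (λ x → ¬ f u ≡ x) (map f W)
  images [] [] _ = []
  images (w ∷ W) (u≢w ∷ rest) W⊆ =
    (λ fu≡fw → u≢w (injective (here refl) (W⊆ (here refl)) fu≡fw)) ∷ images W rest (λ b∈W → W⊆ (there b∈W))

length-cartesianProductWith : {A B C : Set} (f : A → B → C) (xs : List A) (ys : List B) →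
  length (cartesianProductWith f xs ys) ≡ length xs * length ys
length-cartesianProductWith f [] ys = refl
length-cartesianProductWith f (x ∷ xs) ys =
  trans (length-++ (map (f x) ys)) (cong₂ _+_ (length-map (f x) ys) (length-cartesianProductWith f xs ys))

record Replaces {p d d'} (B : List (Grp p d')) (A : List (Grp p d)) : Set where
  constructor replaces
  field
    unique : Unique B
    same-size : length B ≡ length A
    fewer-differences : card-diff B ≤ card-diff A

Replaces-refl : ∀ {p d} (A : List (Grp p d)) → Unique A → Replaces A A
Replaces-refl A uniqueA = replaces uniqueA refl ≤-refl

Replaces-trans : ∀ {p d d' d''} {C : List (Grp p d'')} {B : List (Grp p d')} {A : List (Grp p d)} →
  Replaces C B → Replaces B A → Replaces C A
Replaces-trans (replaces uniqueC |C|≡|B| C≤B) (replaces _ |B|≡|A| B≤A) =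
  replaces uniqueC (trans |C|≡|B| |B|≡|A|) (≤-trans C≤B B≤A)

Reduces : ℕ → ℕ → ℕ → ℕ → Set
Reduces p d d' r = (A : List (Grp p d)) → Unique A → length A ≡ r → ∃ λ (B : List (Grp p d')) → Replaces B A

IsRho-transfer : ∀ {p d d' r m} → Reduces p d d' r → Reduces p d' d r → IsRho p d r m → IsRho p d' r m
IsRho-transfer {r = r} {m} down up ((A , uniqueA , |A|≡r , |A-A|≡m) , minimal) with down A uniqueA |A|≡r
... | B , replaces uniqueB |B|≡|A| B≤A =
  (B , uniqueB , |B|≡r , ≤-antisym (≤-trans B≤A (≤-reflexive |A-A|≡m)) (bound B uniqueB |B|≡r)) , bound
  where
  |B|≡r : length B ≡ r
  |B|≡r = trans |B|≡|A| |A|≡r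
  bound : ∀ B' → Unique B' → length B' ≡ r → m ≤ card-diff B'
  bound B' uniqueB' |B'|≡r with up B' uniqueB' |B'|≡r
  ... | A' , replaces uniqueA' |A'|≡|B'| A'≤B' = ≤-trans (minimal A' uniqueA' (trans |A'|≡|B'| |B'|≡r)) A'≤B'

module Groups (n : ℕ) where
  open ZMod n

  G : ℕ → Set
  G = Grp P

  0ᴳ : ∀ {k} → G k
  0ᴳ {k} = replicate k 0F

  -ᴳ-self : ∀ {k} (x : G k) → x -ᴳ x ≡ 0ᴳ
  -ᴳ-self [] = refl
  -ᴳ-self (x ∷ xs) = cong₂ _∷_ (-ₚ-self x) (-ᴳ-self xs)

  -ᴳ≡0ᴳ⇒≡ : ∀ {k} (x y : G k) → x -ᴳ y ≡ 0ᴳ → x ≡ y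
  -ᴳ≡0ᴳ⇒≡ [] [] _ = refl
  -ᴳ≡0ᴳ⇒≡ (x ∷ xs) (y ∷ ys) eq with ∷-injective eq
  ... | x-y≡0 , xs-ys≡0 = cong₂ _∷_ (-ₚ≡0⇒≡ x-y≡0) (-ᴳ≡0ᴳ⇒≡ xs ys xs-ys≡0)

  elements : ∀ k → List (G k)
  elements zero = [] ∷ []
  elements (suc k) = cartesianProductWith _∷_ (allFin P) (elements k)

  elements-unique : ∀ k → Unique (elements k)
  elements-unique zero = [] ∷ []
  elements-unique (suc k) = Unique.cartesianProductWith⁺ _∷_ ∷-injective (Unique.allFin⁺ P) (elements-unique k)

  ∈-elements : ∀ {k} (x : G k) → x ∈ elements k
  ∈-elements [] = here refl
  ∈-elements (x ∷ xs) = ∈-cartesianProductWith⁺ _∷_ (∈-allFin x) (∈-elements xs)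

  length-elements : ∀ k → length (elements k) ≡ P ^ k
  length-elements zero = refl
  length-elements (suc k) =
    trans (length-cartesianProductWith _∷_ (allFin P) (elements k))
          (cong₂ _*_ (length-tabulate {n = P} (λ x → x)) (length-elements k))

  DiffSet : ∀ {k} → List (G k) → List (G k)
  DiffSet A = deduplicate _≟ᴳ_ (diffList A)

  DiffSet-unique : ∀ {k} (A : List (G k)) → Unique (DiffSet A)
  DiffSet-unique A = deduplicate-! _≟ᴳ_ (diffList A)

  ∈-DiffSet⁺ : ∀ {k} {A : List (G k)} {a b} → a ∈ A → b ∈ A → a -ᴳ b ∈ DiffSet A
  ∈-DiffSet⁺ {A = A} {a} a∈A b∈A = Equivalence.to (deduplicate-∈⇔ _≟ᴳ_)
    (∈-concatMap⁺ (λ a → map (λ b → a -ᴳ b) A) (lose a∈A (∈-map⁺ (λ b → a -ᴳ b) b∈A)))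

  ∈-DiffSet⁻ : ∀ {k} {A : List (G k)} {z} → z ∈ DiffSet A → ∃ λ a → ∃ λ b → a ∈ A × b ∈ A × z ≡ a -ᴳ b
  ∈-DiffSet⁻ {A = A} z∈ with find (∈-concatMap⁻ (λ a → map (λ b → a -ᴳ b) A) {xs = A}
                                   (Equivalence.from (deduplicate-∈⇔ _≟ᴳ_) z∈))
  ... | a , a∈A , z∈aA with ∈-map⁻ (λ b → a -ᴳ b) z∈aA
  ... | b , b∈A , z≡a-b = a , b , a∈A , b∈A , z≡a-b

  card-diff-≤-order : ∀ {k} (B : List (G k)) → card-diff B ≤ P ^ k
  card-diff-≤-order {k} B = ≤-trans (⊆-length _≟ᴳ_ (DiffSet-unique B) (λ {z} _ → ∈-elements z))
                                    (≤-reflexive (length-elements k))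

  InjectiveOn : ∀ {k k'} → (G k → G k') → List (G k) → Set
  InjectiveOn f A = ∀ {a b} → a ∈ A → b ∈ A → f a ≡ f b → a ≡ b

  IsHom : ∀ {k k'} → (G k → G k') → Set
  IsHom f = ∀ a b → f a -ᴳ f b ≡ f (a -ᴳ b)

  -- The image of A under a homomorphism f, if f is injective on A, replaces A:
  -- f(A) - f(A) = f(A - A).
  image-replaces : ∀ {k k'} (f : G k → G k') → IsHom f → (A : List (G k)) → Unique A →
    InjectiveOn f A → Replaces (map f A) A
  image-replaces f hom A uniqueA injective =
    replaces (map-Unique f A uniqueA injective) (length-map f A)
    (≤-trans (⊆-length _≟ᴳ_ (DiffSet-unique (map f A)) image⊆) (≤-reflexive (length-map f (DiffSet A))))
    where
    image⊆ : ∀ {z} → z ∈ DiffSet (map f A) → z ∈ map f (DiffSet A)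
    image⊆ z∈ with ∈-DiffSet⁻ {A = map f A} z∈
    ... | fa , fb , fa∈ , fb∈ , z≡fa-fb with ∈-map⁻ f {xs = A} fa∈ | ∈-map⁻ f {xs = A} fb∈
    ... | a , a∈A , refl | b , b∈A , refl =
      subst (_∈ map f (DiffSet A)) (sym (trans z≡fa-fb (hom a b))) (∈-map⁺ f (∈-DiffSet⁺ a∈A b∈A))

module Projections (n : ℕ) (isPrime : Prime (suc n)) where
  open ZMod n
  open Groups n

  _·_ : ∀ {k} → Fin P → G k → G k
  x₀ · c = vmap (x₀ *ₚ_) c

  ·-zeroˡ : ∀ {k} (c : G k) → 0F · c ≡ 0ᴳ
  ·-zeroˡ [] = refl
  ·-zeroˡ (c ∷ cs) = cong₂ _∷_ (*ₚ-zeroˡ c) (·-zeroˡ cs)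

  ·-cancelˡ : ∀ {k} {w} (c c' : G k) → w ≢ 0F → w · c ≡ w · c' → c ≡ c'
  ·-cancelˡ [] [] _ _ = refl
  ·-cancelˡ (c ∷ cs) (c' ∷ cs') w≢0 eq with ∷-injective eq
  ... | wc≡wc' , wcs≡wcs' = cong₂ _∷_ (*ₚ-cancelˡ isPrime w≢0 wc≡wc') (·-cancelˡ cs cs' w≢0 wcs≡wcs')

  π : ∀ {k} → G k → G (suc k) → G k
  π c (x₀ ∷ x) = x -ᴳ (x₀ · c)

  -ᴳ-affine : ∀ {k} a₀ b₀ (a b c : G k) →
    (a -ᴳ (a₀ · c)) -ᴳ (b -ᴳ (b₀ · c)) ≡ (a -ᴳ b) -ᴳ ((a₀ -ₚ b₀) · c)
  -ᴳ-affine a₀ b₀ [] [] [] = refl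
  -ᴳ-affine a₀ b₀ (a ∷ as) (b ∷ bs) (c ∷ cs) = cong₂ _∷_ (-ₚ-affine a b a₀ b₀ c) (-ᴳ-affine a₀ b₀ as bs cs)

  π-hom : ∀ {k} (c : G k) → IsHom (π c)
  π-hom c (a₀ ∷ a) (b₀ ∷ b) = -ᴳ-affine a₀ b₀ a b c

  π-identifies : ∀ {k} (c : G k) a b → π c a ≡ π c b → π c (a -ᴳ b) ≡ 0ᴳ
  π-identifies c a b πa≡πb = begin
    π c (a -ᴳ b)        ≡⟨ π-hom c a b ⟨
    π c a -ᴳ π c b      ≡⟨ cong (_-ᴳ π c b) πa≡πb ⟩
    π c b -ᴳ π c b      ≡⟨ -ᴳ-self (π c b) ⟩
    0ᴳ                  ∎
    where open ≡-Reasoning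

  π-kernel-flat : ∀ {k} (c : G k) (w : G (suc k)) → head w ≡ 0F → π c w ≡ 0ᴳ → w ≡ 0ᴳ
  π-kernel-flat c (.0F ∷ w) refl πw≡0 =
    cong (0F ∷_) (-ᴳ≡0ᴳ⇒≡ w 0ᴳ (trans (cong (w -ᴳ_) (sym (·-zeroˡ c))) πw≡0))

  Kills : ∀ {k} → G k → G (suc k) → Set
  Kills c w = head w ≢ 0F × π c w ≡ 0ᴳ

  kills? : ∀ {k} (c : G k) (w : G (suc k)) → Dec (Kills c w)
  kills? c w = ¬? (head w ≟F 0F) ×-dec (π c w ≟ᴳ 0ᴳ)

  -- A nonflat vector w = (w₀, w') is killed by at most one slope, namely c = w'/w₀.
  kills-unique : ∀ {k} {c c' : G k} {w} → Kills c w → Kills c' w → c ≡ c'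
  kills-unique {c = c} {c'} {w₀ ∷ w} (w₀≢0 , πw≡0) (_ , π'w≡0) =
    ·-cancelˡ c c' w₀≢0 (trans (sym (-ᴳ≡0ᴳ⇒≡ w _ πw≡0)) (-ᴳ≡0ᴳ⇒≡ w _ π'w≡0))

  -- If |A - A| < P^k, one of the P^k slopes kills no difference of A, and the
  -- corresponding projection is injective on A.
  injective-projection : ∀ {k} (A : List (G (suc k))) → card-diff A < P ^ k →
    ∃ λ (c : G k) → InjectiveOn (π c) A
  injective-projection {k} A small
    with Counting.unrelated-exists Kills kills? (λ {_} {_} {w} → kills-unique {w = w}) (DiffSet A) (elements k) (elements-unique k) (subst (card-diff A <_) (sym (length-elements k)) small)
  ... | c , _ , kills-nothing = c , injective
    where
    injective : InjectiveOn (π c) A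
    injective {a} {b} a∈A b∈A πa≡πb with head (a -ᴳ b) ≟F 0F
    ... | yes flat = -ᴳ≡0ᴳ⇒≡ a b (π-kernel-flat c (a -ᴳ b) flat (π-identifies c a b πa≡πb))
    ... | no nonflat = ⊥-elim (kills-nothing (lose (∈-DiffSet⁺ a∈A b∈A) (nonflat , π-identifies c a b πa≡πb)))

module Reductions (n : ℕ) (isPrime : Prime (suc n)) where
  open ZMod n
  open Groups n
  open Projections n isPrime

  embedding : ∀ {d₂ d r} → d₂ ≤′ d → Reduces P d₂ d r
  embedding ≤′-refl A uniqueA _ = A , Replaces-refl A uniqueA
  embedding (≤′-step d₂≤d) A uniqueA |A|≡r with embedding d₂≤d A uniqueA |A|≡r
  ... | B , B-replaces@(replaces uniqueB _ _) =
    map (0F ∷_) B , Replaces-trans (image-replaces (0F ∷_) pad-hom B uniqueB (λ _ _ → ∷-injectiveʳ)) B-replaces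
    where
    pad-hom : IsHom (0F ∷_)
    pad-hom a b = cong (_∷ (a -ᴳ b)) (-ₚ-self 0F)

  projecting : ∀ {d₂ k} → d₂ ≤′ k → (A : List (G k)) → Unique A → card-diff A < P ^ d₂ →
    ∃ λ (B : List (G d₂)) → Replaces B A
  projecting ≤′-refl A uniqueA _ = A , Replaces-refl A uniqueA
  projecting {d₂} (≤′-step d₂≤k) A uniqueA small
    with injective-projection A (<-≤-trans small (^-monoʳ-≤ P (≤′⇒≤ d₂≤k)))
  ... | c , injective with image-replaces (π c) (π-hom c) A uniqueA injective
  ... | πA-replaces@(replaces uniqueπA _ πA≤A) with projecting d₂≤k (map (π c) A) uniqueπA (≤-<-trans πA≤A small)
  ... | B , B-replaces = B , Replaces-trans B-replaces πA-replaces

  -- Downwards in general: if |A - A| ≥ P^d₂, any r-subset of (ℤ/Pℤ)^d₂ will do.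
  compression : ∀ {d₂ d r} → d₂ ≤ d → r ≤ P ^ d₂ → Reduces P d d₂ r
  compression {d₂} {r = r} d₂≤d r≤P^d₂ A uniqueA |A|≡r with P ^ d₂ ≤? card-diff A
  ... | yes large =
    B , replaces (Unique.take⁺ r (elements-unique d₂)) (trans |B|≡r (sym |A|≡r)) (≤-trans (card-diff-≤-order B) large)
    where
    B : List (G d₂)
    B = take r (elements d₂)
    |B|≡r : length B ≡ r
    |B|≡r = trans (length-take r (elements d₂)) (trans (cong (r ⊓_) (length-elements d₂)) (m≤n⇒m⊓n≡m r≤P^d₂))
  ... | no not-large = projecting (≤⇒≤′ d₂≤d) A uniqueA (≰⇒> not-large)

lemma5p1 : (p : ℕ) → Prime p → (d₁ d₂ : ℕ) → d₂ < d₁ →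
    (r : ℕ) → 1 ≤ r → r ≤ p ^ d₂ →
    (m : ℕ) → IsRho p d₁ r m ⇔ IsRho p d₂ r m
lemma5p1 zero isPrime _ _ _ _ _ _ _ = ⊥-elim (¬prime[0] isPrime)
lemma5p1 (suc n) isPrime d₁ d₂ d₂<d₁ r _ r≤p^d₂ m =
  mk⇔ (IsRho-transfer down up) (IsRho-transfer up down)
  where
  open Reductions n isPrime
  down : Reduces (suc n) d₁ d₂ r
  down = compression (<⇒≤ d₂<d₁) r≤p^d₂
  up : Reduces (suc n) d₂ d₁ r
  up = embedding (≤⇒≤′ (<⇒≤ d₂<d₁))
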